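{- Let $A$ be a commutative ring with identity and $HA$ the ring of Hurwitz series over $A$. Let $n\in\mathbb{N}^+$, $f\in HA$ and $z_0,\dots,z_{n-1}\in HA$. Then $$f\cdot\mathrm{intl}(z_0,\dots,z_{n-1})=\mathrm{intl}(h_0,\dots,h_{n-1}),$$ where for each $0\le i\le n-1$, $$h_i=\sum_{k\in\mathbb{N},\ i<\overline{k}}\int^{\widehat{k}+1}f(k)\,C^{n-\overline{k}+k+i}_{k,n}\boxdot z_{n-\overline{k}+i}\;+\;\sum_{k\in\mathbb{N},\ i\ge\overline{k}}\int^{\widehat{k}}f(k)\,C^{i-\overline{k}+k}_{k,n}\boxdot z_{i-\overline{k}},$$ with $\widehat{k}=\lfloor k/n\rfloor$, $\overline{k}=k-\widehat{k}n$, and the infinite sums taken componentwise (each component is a finite sum).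
   Context: $HA$ is the set of sequences $f=(f(0),f(1),\dots)$ with entries in $A$, with componentwise addition and product $(fg)(m)=\sum_{i=0}^m\binom{m}{i}f(i)g(m-i)$; scalar multiplication by $a\in A$ is componentwise. The integral is $\int f=(0,f(0),f(1),\dots)$, $\int^m$ its $m$-fold iterate ($\int^0=\mathrm{id}$). For fixed $n\in\mathbb{N}^+$ and $m\in\mathbb{N}$, $\widehat{m}=\lfloor m/n\rfloor$, $\overline{m}=m-\widehat{m}n$. The interlacing $\mathrm{intl}(z_0,\dots,z_{n-1})\in HA$ is given by $\mathrm{intl}(z_0,\dots,z_{n-1})(m)=z_{\overline{m}}(\widehat{m})$. The Hadamard product is $(f\boxdot g)(p)=f(p)g(p)$. For $\ell,k\in\mathbb{N}$, $C^{\ell}_{k,n}\in HA$ is defined by $C^{\ell}_{k,n}(p)=\binom{\ell+pn}{k}$ (with $\binom{a}{b}=0$ if $a<b$). -}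

module Defs where

open import Level using (Level)
open import Algebra.Bundles using (CommutativeRing)
open import Data.Nat.Base as ℕ using (ℕ; zero; suc; NonZero; _<ᵇ_; _∸_)
open import Data.Nat.DivMod using (_/_)
open import Data.Nat.Combinatorics using (_C_)
open import Data.Bool.Base using (if_then_else_)
open import Data.Product.Base using (∃; _×_)
open import Relation.Binary.PropositionalEquality using (_≡_)

module Hurwitz {c ℓ : Level} (R : CommutativeRing c ℓ) where
  open CommutativeRing R

  HA : Set c
  HA = ℕ → Carrier

  infix 4 _≈ₕ_
  _≈ₕ_ : HA → HA → Set ℓ
  f ≈ₕ g = ∀ m → f m ≈ g m

  ι : ℕ → Carrier
  ι zero = 0#
  ι (suc k) = 1# + ι k

  sumTo : ℕ → (ℕ → Carrier) → Carrier
  sumTo zero g = 0#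
  sumTo (suc M) g = sumTo M g + g M

  infixl 6 _+ₕ_
  _+ₕ_ : HA → HA → HA
  (f +ₕ g) m = f m + g m

  0ₕ : HA
  0ₕ m = 0#

  infixl 7 _·ₕ_
  _·ₕ_ : HA → HA → HA
  (f ·ₕ g) m = sumTo (suc m) (λ i → ι (m C i) * f i * g (m ∸ i))

  infixr 7 _⋆_
  _⋆_ : Carrier → HA → HA
  (a ⋆ f) m = a * f m

  infixl 7 _⊡_
  _⊡_ : HA → HA → HA
  (f ⊡ g) p = f p * g p

  ∫ : HA → HA
  ∫ f zero = 0#
  ∫ f (suc m) = f m

  ∫^ : ℕ → HA → HA
  ∫^ zero f = f
  ∫^ (suc m) f = ∫ (∫^ m f)

  module _ (n : ℕ) .{{_ : NonZero n}} where
    hat : ℕ → ℕ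
    hat m = m / n

    bar : ℕ → ℕ
    bar m = m ∸ hat m ℕ.* n

    -- interlacing of z_0,...,z_{n-1} (only indices < n are ever used)
    intl : (ℕ → HA) → HA
    intl z m = z (bar m) (hat m)

    Cf : ℕ → ℕ → HA
    Cf l k p = ι ((l ℕ.+ p ℕ.* n) C k)

  SumsTo : (ℕ → HA) → HA → Set ℓ
  SumsTo F s = ∀ p → ∃ λ N → ∀ M → N ℕ.≤ M → sumTo M (λ k → F k p) ≈ s p

  module _ (n : ℕ) .{{_ : NonZero n}} (f : HA) (z : ℕ → HA) where
    term₁ : ℕ → ℕ → HA
    term₁ i k = if i <ᵇ bar n k
      then ∫^ (suc (hat n k)) (f k ⋆ (Cf n ((n ∸ bar n k) ℕ.+ k ℕ.+ i) k ⊡ z ((n ∸ bar n k) ℕ.+ i)))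
      else 0ₕ

    term₂ : ℕ → ℕ → HA
    term₂ i k = if i <ᵇ bar n k
      then 0ₕ
      else ∫^ (hat n k) (f k ⋆ (Cf n ((i ∸ bar n k) ℕ.+ k) k ⊡ z (i ∸ bar n k)))

-- Write m = i + q n and k = b + h n with i, b < n.  The k-th summand of
-- (f · intl z)(m) is binom(m,k) f(k) z_r(d) where m - k = r + d n; computing
-- m - k digitwise in base n gives r = n - b + i, d = q - h - 1 when i < b
-- (a borrow) and r = i - b, d = q - h when b ≤ i.  The k-th term of the first
-- (resp. second) sum of h_i evaluated at q is exactly this summand in the borrow
-- (resp. non-borrow) case; the remaining combinations have k > m, where both the
-- summand and the term vanish.
module Submission where

open import Defs
open import Level using (Level)
open import Algebra.Bundles using (CommutativeRing)
open import Data.Nat.Base as Nat using (ℕ; NonZero; suc; _∸_; _≤_; _<_; _<ᵇ_; _⊔_)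
open import Data.Nat.Properties
  using ( ≤-trans; <⇒≤; ≤-<-trans; <-≤-trans; ≮⇒≥; _<?_; <ᵇ-reflects-<
        ; m≤n+m; m≤n⇒m≤1+n; m∸n≤m; m+n∸m≡n; m+[n∸m]≡n; m∸n+n≡m; m≤m⊔n; m≤n⊔m
        ; +-monoʳ-<; +-monoˡ-<; +-mono-<-≤; *-monoˡ-≤ )
open import Data.Nat.DivMod
  using ( _/_; _%_; m≡m%n+[m/n]*n; m%n≡m∸m/n*n; m%n<n; [m+kn]%n≡m%n
        ; m<n⇒m%n≡m; m<n⇒m/n≡0; m*n/n≡m; m*n%n≡0; +-distrib-/; /-monoˡ-≤ )
open import Data.Nat.Combinatorics using (_C_; k>n⇒nCk≡0)
open import Data.Nat.Tactic.RingSolver using (solve-∀)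
open import Data.Bool.Base using (Bool; if_then_else_)
open import Data.Product.Base using (∃; _×_; _,_; proj₁; proj₂)
open import Relation.Nullary using (¬_; yes; no)
open import Relation.Nullary.Reflects using (Reflects; ofʸ; ofⁿ)
open import Relation.Binary.PropositionalEquality as ≡ using (_≡_)

module EuclideanDivision (n : ℕ) .{{_ : NonZero n}} where
  open Nat using (_+_; _*_)
  open import Data.Nat.Properties using (+-identityʳ)

  [r+dn]%n≡r : ∀ {r} d → r < n → (r + d * n) % n ≡ r
  [r+dn]%n≡r {r} d r<n = ≡.trans ([m+kn]%n≡m%n r d n) (m<n⇒m%n≡m r<n)

  [r+dn]/n≡d : ∀ {r} d → r < n → (r + d * n) / n ≡ d
  [r+dn]/n≡d {r} d r<n = ≡.trans (+-distrib-/ r (d * n) digits<n)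
                               (≡.cong₂ _+_ (m<n⇒m/n≡0 r<n) (m*n/n≡m d n))
    where
    digits<n : r % n + (d * n) % n < n
    digits<n = ≡.subst (_< n)
      (≡.sym (≡.trans (≡.cong₂ _+_ (m<n⇒m%n≡m r<n) (m*n%n≡0 d n)) (+-identityʳ r))) r<n

  [1+p]*n≤k⇒p<k/n : ∀ p {k} → suc p * n ≤ k → p < k / n
  [1+p]*n≤k⇒p<k/n p {k} le = ≡.subst (_≤ k / n) (m*n/n≡m (suc p) n) (/-monoˡ-≤ n le)

  borrow-decomposition : ∀ {i b h q} → b ≤ n → h < q →
    i + q * n ≡ (b + h * n) + ((n ∸ b + i) + (q ∸ suc h) * n)
  borrow-decomposition {i} {b} {h} {q} b≤n h<q = begin
    i + q * n                       ≡⟨ ≡.cong (λ x → i + x * n) (≡.sym (m+[n∸m]≡n h<q)) ⟩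
    i + (suc h + d) * n             ≡⟨ expand i h d n ⟩
    i + n + h * n + d * n           ≡⟨ ≡.cong (λ x → i + x + h * n + d * n) (≡.sym (m∸n+n≡m b≤n)) ⟩
    i + (n ∸ b + b) + h * n + d * n ≡⟨ regroup i (n ∸ b) b h d n ⟩
    (b + h * n) + ((n ∸ b + i) + d * n) ∎
    where
    open ≡.≡-Reasoning
    d = q ∸ suc h
    expand : ∀ i h d n → i + (suc h + d) * n ≡ i + n + h * n + d * n
    expand = solve-∀
    regroup : ∀ i c b h d n → i + (c + b) + h * n + d * n ≡ (b + h * n) + ((c + i) + d * n)
    regroup = solve-∀

  no-borrow-decomposition : ∀ {i b h q} → b ≤ i → h ≤ q →
    i + q * n ≡ (b + h * n) + ((i ∸ b) + (q ∸ h) * n)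
  no-borrow-decomposition {i} {b} {h} {q} b≤i h≤q = begin
    i + q * n                 ≡⟨ ≡.cong₂ (λ x y → x + y * n) (≡.sym (m+[n∸m]≡n b≤i)) (≡.sym (m+[n∸m]≡n h≤q)) ⟩
    b + e + (h + d) * n       ≡⟨ regroup b e h d n ⟩
    (b + h * n) + (e + d * n) ∎
    where
    open ≡.≡-Reasoning
    e = i ∸ b
    d = q ∸ h
    regroup : ∀ b e h d n → b + e + (h + d) * n ≡ (b + h * n) + (e + d * n)
    regroup = solve-∀

  borrow-overflow : ∀ {i b h q} → i < b → q ≤ h → i + q * n < b + h * n
  borrow-overflow i<b q≤h = +-mono-<-≤ i<b (*-monoˡ-≤ n q≤h)

  quotient-overflow : ∀ {i b h q} → i < n → q < h → i + q * n < b + h * n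
  quotient-overflow {i} {b} {h} {q} i<n q<h =
    <-≤-trans (+-monoˡ-< (q * n) i<n) (≤-trans (*-monoˡ-≤ n q<h) (m≤n+m (h * n) b))

module Summation {c ℓ : Level} (R : CommutativeRing c ℓ) where
  open CommutativeRing R
  open Hurwitz R
  open import Algebra.Properties.CommutativeSemigroup +-commutativeSemigroup
    using (interchange)
  open import Relation.Binary.Reasoning.Setoid setoid

  HasSum : (ℕ → Carrier) → Carrier → Set ℓ
  HasSum a s = ∃ λ N → ∀ M → N ≤ M → sumTo M a ≈ s

  sumTo-cong : ∀ M {a b : ℕ → Carrier} → (∀ k → a k ≈ b k) → sumTo M a ≈ sumTo M b
  sumTo-cong Nat.zero    a≈b = refl
  sumTo-cong (suc M) a≈b = +-cong (sumTo-cong M a≈b) (a≈b M)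

  sumTo-+ : ∀ M (a b : ℕ → Carrier) → sumTo M (λ k → a k + b k) ≈ sumTo M a + sumTo M b
  sumTo-+ Nat.zero    a b = sym (+-identityʳ 0#)
  sumTo-+ (suc M) a b = trans (+-congʳ (sumTo-+ M a b)) (interchange _ _ _ _)

  sumTo-+-vanishing : ∀ N d (a : ℕ → Carrier) → (∀ k → N ≤ k → a k ≈ 0#) →
    sumTo (d Nat.+ N) a ≈ sumTo N a
  sumTo-+-vanishing N Nat.zero    a a≈0 = refl
  sumTo-+-vanishing N (suc d) a a≈0 =
    trans (+-cong (sumTo-+-vanishing N d a a≈0) (a≈0 (d Nat.+ N) (m≤n+m N d))) (+-identityʳ _)

  hasSum-finite : ∀ N {a : ℕ → Carrier} → (∀ k → N ≤ k → a k ≈ 0#) → HasSum a (sumTo N a)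
  hasSum-finite N {a} a≈0 = N , λ M N≤M →
    trans (reflexive (≡.cong (λ x → sumTo x a) (≡.sym (m∸n+n≡m N≤M))))
          (sumTo-+-vanishing N (M ∸ N) a a≈0)

  hasSum-cong : ∀ {a b s} → (∀ k → a k ≈ b k) → HasSum a s → HasSum b s
  hasSum-cong a≈b (N , sum) = N , λ M N≤M → trans (sym (sumTo-cong M a≈b)) (sum M N≤M)

  hasSum-+ : ∀ {a b s t} → HasSum a s → HasSum b t → HasSum (λ k → a k + b k) (s + t)
  hasSum-+ {a} {b} (N₁ , sum₁) (N₂ , sum₂) = N₁ ⊔ N₂ , λ M N≤M →
    trans (sumTo-+ M a b)
          (+-cong (sum₁ M (≤-trans (m≤m⊔n N₁ N₂) N≤M)) (sum₂ M (≤-trans (m≤n⊔m N₁ N₂) N≤M)))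

  hasSum-unique : ∀ {a s t} → HasSum a s → HasSum a t → s ≈ t
  hasSum-unique (N₁ , sum₁) (N₂ , sum₂) =
    trans (sym (sum₁ _ (m≤m⊔n N₁ N₂))) (sum₂ _ (m≤n⊔m N₁ N₂))

  summable-if-eventually-zero : (F : ℕ → HA) →
    (∀ p → ∃ λ N → ∀ k → N ≤ k → F k p ≈ 0#) → ∃ λ s → SumsTo F s
  summable-if-eventually-zero F vanishing =
    (λ p → sumTo (proj₁ (vanishing p)) (λ k → F k p)) ,
    (λ p → hasSum-finite (proj₁ (vanishing p)) (proj₂ (vanishing p)))

  binomial-vanishes : ∀ {m k} a b → m < k → ι (m C k) * a * b ≈ 0#
  binomial-vanishes {m} {k} a b m<k = begin
    ι (m C k) * a * b ≡⟨ ≡.cong (λ x → ι x * a * b) (k>n⇒nCk≡0 m<k) ⟩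
    0# * a * b        ≈⟨ trans (*-congʳ (zeroˡ a)) (zeroˡ b) ⟩
    0#                ∎

  product-hasSum : ∀ (f g : HA) m → HasSum (λ k → ι (m C k) * f k * g (m ∸ k)) ((f ·ₕ g) m)
  product-hasSum f g m = hasSum-finite (suc m) λ k m<k → binomial-vanishes (f k) (g (m ∸ k)) m<k

  ∫^-shift : ∀ j (g : HA) d → ∫^ j g (j Nat.+ d) ≡ g d
  ∫^-shift Nat.zero    g d = ≡.refl
  ∫^-shift (suc j) g d = ∫^-shift j g d

  ∫^-vanishes : ∀ j (g : HA) {q} → q < j → ∫^ j g q ≡ 0#
  ∫^-vanishes (suc j) g {Nat.zero}  _            = ≡.refl
  ∫^-vanishes (suc j) g {suc q} (Nat.s≤s q<j) = ∫^-vanishes j g q<j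

  if-reflects-+ : ∀ {P : Set} {b : Bool} (X Y : HA) q {r} → Reflects P b →
    (P → X q ≈ r) → (¬ P → Y q ≈ r) →
    (if b then X else 0ₕ) q + (if b then 0ₕ else Y) q ≈ r
  if-reflects-+ X Y q (ofʸ p)  X≈r _   = trans (+-identityʳ _) (X≈r p)
  if-reflects-+ X Y q (ofⁿ ¬p) _   Y≈r = trans (+-identityˡ _) (Y≈r ¬p)

  if-pointwise : ∀ (b : Bool) {X Y : HA} {p r} → X p ≈ r → Y p ≈ r → (if b then X else Y) p ≈ r
  if-pointwise Bool.true  X≈r _   = X≈r
  if-pointwise Bool.false _   Y≈r = Y≈r

module Interlacing {c ℓ : Level} (R : CommutativeRing c ℓ) (n : ℕ) .{{_ : NonZero n}} where
  open Hurwitz R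
  open EuclideanDivision n
  open Nat using (_+_; _*_)

  bar≡% : ∀ m → bar n m ≡ m % n
  bar≡% m = ≡.sym (m%n≡m∸m/n*n m n)

  bar<n : ∀ m → bar n m < n
  bar<n m = ≡.subst (_< n) (≡.sym (bar≡% m)) (m%n<n m n)

  bar+hat*n≡m : ∀ m → bar n m + hat n m * n ≡ m
  bar+hat*n≡m m = ≡.sym (≡.trans (m≡m%n+[m/n]*n m n) (≡.cong (_+ hat n m * n) (≡.sym (bar≡% m))))

  intl-euclid : ∀ (z : ℕ → HA) {r} d → r < n → intl n z (r + d * n) ≡ z r d
  intl-euclid z d r<n =
    ≡.cong₂ z (≡.trans (bar≡% (_ + d * n)) ([r+dn]%n≡r d r<n)) ([r+dn]/n≡d d r<n)

  digits-decomposition : ∀ {m k r d} →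
    bar n m + hat n m * n ≡ (bar n k + hat n k * n) + (r + d * n) → m ≡ k + (r + d * n)
  digits-decomposition {m} {k} eq =
    ≡.trans (≡.sym (bar+hat*n≡m m)) (≡.trans eq (≡.cong (_+ _) (bar+hat*n≡m k)))

  digits-< : ∀ {m k} → bar n m + hat n m * n < bar n k + hat n k * n → m < k
  digits-< {m} {k} = ≡.subst₂ _<_ (bar+hat*n≡m m) (bar+hat*n≡m k)

module Product {c ℓ : Level} (R : CommutativeRing c ℓ) (n : ℕ) .{{_ : NonZero n}}
               (f : Hurwitz.HA R) (z : ℕ → Hurwitz.HA R) where
  open Hurwitz R
  open CommutativeRing R using (Carrier; _≈_; 0#; refl; sym; trans; reflexive; *-assoc; *-comm; *-congʳ)
  module A = CommutativeRing R
  open Summation R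
  open EuclideanDivision n
  open Interlacing R n
  open Nat using (_+_; _*_)
  open import Relation.Binary.Reasoning.Setoid A.setoid

  summand : ℕ → ℕ → Carrier
  summand m k = ι (m C k) A.* f k A.* intl n z (m ∸ k)

  summand-vanishes : ∀ {m k} → m < k → summand m k ≈ 0#
  summand-vanishes {m} {k} = binomial-vanishes (f k) (intl n z (m ∸ k))

  ∫^-summand : ∀ {m k} j d r l → r < n →
    m ≡ k + (r + d * n) → l ≡ r + k → hat n m ≡ j + d →
    ∫^ j (f k ⋆ (Cf n l k ⊡ z r)) (hat n m) ≈ summand m k
  ∫^-summand {m} {k} j d r l r<n m≡k+[r+dn] l≡r+k q≡j+d = begin
    ∫^ j G (hat n m)                         ≡⟨ ≡.cong (∫^ j G) q≡j+d ⟩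
    ∫^ j G (j + d)                           ≡⟨ ∫^-shift j G d ⟩
    f k A.* (ι ((l + d * n) C k) A.* z r d)  ≡⟨ ≡.cong₂ (λ x y → f k A.* (ι (x C k) A.* y)) l+dn≡m z≡intl ⟩
    f k A.* (ι (m C k) A.* intl n z (m ∸ k)) ≈⟨ sym (*-assoc _ _ _) ⟩
    f k A.* ι (m C k) A.* intl n z (m ∸ k)   ≈⟨ *-congʳ (*-comm _ _) ⟩
    summand m k                              ∎
    where
    G = f k ⋆ (Cf n l k ⊡ z r)
    regroup : ∀ r k d n → r + k + d * n ≡ k + (r + d * n)
    regroup = solve-∀
    l+dn≡m : l + d * n ≡ m
    l+dn≡m = ≡.trans (≡.cong (_+ d * n) l≡r+k) (≡.trans (regroup r k d n) (≡.sym m≡k+[r+dn]))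
    z≡intl : z r d ≡ intl n z (m ∸ k)
    z≡intl = ≡.sym (≡.trans (≡.cong (intl n z) (≡.trans (≡.cong (_∸ k) m≡k+[r+dn]) (m+n∸m≡n k _)))
                            (intl-euclid z d r<n))

  first-term second-term : ℕ → ℕ → HA
  first-term i k = ∫^ (suc (hat n k)) (f k ⋆ (Cf n ((n ∸ bar n k) + k + i) k ⊡ z ((n ∸ bar n k) + i)))
  second-term i k = ∫^ (hat n k) (f k ⋆ (Cf n ((i ∸ bar n k) + k) k ⊡ z (i ∸ bar n k)))

  first-term-summand : ∀ m k → bar n m < bar n k → first-term (bar n m) k (hat n m) ≈ summand m k
  first-term-summand m k i<b with hat n k <? hat n m
  ... | yes h<q = ∫^-summand (suc h) (q ∸ suc h) (n ∸ b + i) _ r<n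
        (digits-decomposition {r = n ∸ b + i} {d = q ∸ suc h} (borrow-decomposition (<⇒≤ (bar<n k)) h<q))
        (swap (n ∸ b) k i) (≡.sym (m+[n∸m]≡n h<q))
    where
    i = bar n m; q = hat n m; b = bar n k; h = hat n k
    r<n : n ∸ b + i < n
    r<n = ≡.subst (n ∸ b + i <_) (m∸n+n≡m (<⇒≤ (bar<n k))) (+-monoʳ-< (n ∸ b) i<b)
    swap : ∀ x k i → x + k + i ≡ x + i + k
    swap = solve-∀
  ... | no q≮h = trans (reflexive (∫^-vanishes (suc (hat n k)) _ (Nat.s≤s (≮⇒≥ q≮h))))
                       (sym (summand-vanishes (digits-< (borrow-overflow i<b (≮⇒≥ q≮h)))))

  second-term-summand : ∀ m k → bar n k ≤ bar n m → second-term (bar n m) k (hat n m) ≈ summand m k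
  second-term-summand m k b≤i with hat n m <? hat n k
  ... | yes q<h = trans (reflexive (∫^-vanishes (hat n k) _ q<h))
                        (sym (summand-vanishes (digits-< (quotient-overflow (bar<n m) q<h))))
  ... | no h≮q = ∫^-summand h (q ∸ h) (i ∸ b) _ r<n
        (digits-decomposition {r = i ∸ b} {d = q ∸ h} (no-borrow-decomposition b≤i (≮⇒≥ h≮q)))
        ≡.refl (≡.sym (m+[n∸m]≡n (≮⇒≥ h≮q)))
    where
    i = bar n m; q = hat n m; b = bar n k; h = hat n k
    r<n : i ∸ b < n
    r<n = ≤-<-trans (m∸n≤m i b) (bar<n m)

  terms≈summand : ∀ m k →
    term₁ n f z (bar n m) k (hat n m) A.+ term₂ n f z (bar n m) k (hat n m) ≈ summand m k
  terms≈summand m k =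
    if-reflects-+ (first-term (bar n m) k) (second-term (bar n m) k) (hat n m)
      (<ᵇ-reflects-< (bar n m) (bar n k))
      (first-term-summand m k) (λ i≮b → second-term-summand m k (≮⇒≥ i≮b))

  terms-vanish-below-hat : ∀ i k p → p < hat n k →
    term₁ n f z i k p ≈ 0# × term₂ n f z i k p ≈ 0#
  terms-vanish-below-hat i k p p<h =
    if-pointwise (i <ᵇ bar n k) (reflexive (∫^-vanishes (suc (hat n k)) _ (m≤n⇒m≤1+n p<h))) refl ,
    if-pointwise (i <ᵇ bar n k) refl (reflexive (∫^-vanishes (hat n k) _ p<h))

  term₁-summable : ∀ i → ∃ λ s → SumsTo (term₁ n f z i) s
  term₁-summable i = summable-if-eventually-zero (term₁ n f z i) λ p →
    suc p * n , λ k le → proj₁ (terms-vanish-below-hat i k p ([1+p]*n≤k⇒p<k/n p le))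

  term₂-summable : ∀ i → ∃ λ s → SumsTo (term₂ n f z i) s
  term₂-summable i = summable-if-eventually-zero (term₂ n f z i) λ p →
    suc p * n , λ k le → proj₂ (terms-vanish-below-hat i k p ([1+p]*n≤k⇒p<k/n p le))

  product-intl : (s₁ s₂ : ℕ → HA) →
    (∀ i → i < n → SumsTo (term₁ n f z i) (s₁ i)) →
    (∀ i → i < n → SumsTo (term₂ n f z i) (s₂ i)) →
    f ·ₕ intl n z ≈ₕ intl n (λ i → s₁ i +ₕ s₂ i)
  product-intl s₁ s₂ sum₁ sum₂ m = hasSum-unique (product-hasSum f (intl n z) m)
    (hasSum-cong (terms≈summand m)
      (hasSum-+ (sum₁ (bar n m) (bar<n m) (hat n m)) (sum₂ (bar n m) (bar<n m) (hat n m))))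

theorem3p11 : ∀ {c ℓ : Level} (R : CommutativeRing c ℓ) → let open Hurwitz R in
    (n : ℕ) .{{_ : NonZero n}} (f : HA) (z : ℕ → HA) →
      ((i : ℕ) → i < n → ∃ λ s → SumsTo (term₁ n f z i) s)
      × ((i : ℕ) → i < n → ∃ λ s → SumsTo (term₂ n f z i) s)
      × ((s₁ s₂ : ℕ → HA) →
          ((i : ℕ) → i < n → SumsTo (term₁ n f z i) (s₁ i)) →
          ((i : ℕ) → i < n → SumsTo (term₂ n f z i) (s₂ i)) →
          f ·ₕ intl n z ≈ₕ intl n (λ i → s₁ i +ₕ s₂ i))
theorem3p11 R n f z = (λ i _ → term₁-summable i) , (λ i _ → term₂-summable i) , product-intl
  where open Product R n f z
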